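{- Let $t\ge2$, $n\ge1$, let $\lambda$ be a partition with $\ell(\lambda)\le tn+1$, and let $c\ge0$ be an integer. Then the $t$-core of $\lambda$ equals the one-row partition $(c)$ if and only if, for all $0\le i\le t-1$, $n_i(\lambda,tn+1)=n+1$ if $i=c$ and $n_i(\lambda,tn+1)=n$ otherwise.
   Context: For $\ell(\lambda)\le m$, $\beta(\lambda,m)=(\lambda_j+m-j)_{j=1}^m$ and $n_i(\lambda,m)$ is the number of its entries congruent to $i$ mod $t$. The $t$-core of $\lambda$ is obtained by successively removing border strips of size $t$ until none can be removed. $(0)$ denotes the empty partition. -}

module Defs where

open import Data.Nat using (ℕ; zero; suc; _+_; _*_; _∸_; _≤_; _<_; _≥_; NonZero)
open import Data.Nat.Properties using (_≟_)
open import Data.Nat.DivMod using (_%_)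
open import Data.List using (List; []; _∷_; length; map; upTo; filter)
open import Data.Nat.ListAction using (sum)
open import Data.List.Relation.Unary.All using (All)
open import Data.List.Relation.Unary.Linked using (Linked)
open import Data.Product using (_×_; Σ; ∃; _,_)
open import Data.Sum using (_⊎_)
open import Relation.Nullary using (¬_)
open import Relation.Binary.PropositionalEquality using (_≡_)
open import Relation.Binary.Construct.Closure.ReflexiveTransitive using (Star)

-- A partition is represented by its list of parts (λ₁, λ₂, …, λ_ℓ):
-- weakly decreasing and all parts positive.  ℓ(λ) = length of the list.
IsPartition : List ℕ → Set
IsPartition λ′ = Linked _≥_ λ′ × All (0 <_) λ′

-- part λ i = λ_{i+1} (0-indexed), with λ_k = 0 beyond the length.
part : List ℕ → ℕ → ℕ
part []       _       = 0
part (x ∷ xs) zero    = x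
part (x ∷ xs) (suc i) = part xs i

size : List ℕ → ℕ
size = sum

row : ℕ → List ℕ
row zero    = []
row (suc c) = suc c ∷ []

-- Cells of the Young diagram (row i, column j), 0-indexed.
InDiagram : List ℕ → ℕ × ℕ → Set
InDiagram λ′ (i , j) = j < part λ′ i

InSkew : List ℕ → List ℕ → ℕ × ℕ → Set
InSkew λ′ μ c = InDiagram λ′ c × ¬ InDiagram μ c

Adjacent : ℕ × ℕ → ℕ × ℕ → Set
Adjacent (i , j) (i′ , j′) =
  (i ≡ i′ × (suc j ≡ j′ ⊎ j ≡ suc j′)) ⊎ (j ≡ j′ × (suc i ≡ i′ ⊎ i ≡ suc i′))

data Path (S : ℕ × ℕ → Set) : ℕ × ℕ → ℕ × ℕ → Set where
  here : ∀ {a} → Path S a a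
  step : ∀ {a b c} → Adjacent a b → S b → Path S b c → Path S a c

BorderStrip : ℕ → List ℕ → List ℕ → Set
BorderStrip t λ′ μ =
  IsPartition μ
  × (∀ i → part μ i ≤ part λ′ i)
  × size λ′ ≡ size μ + t
  × (∀ a b → InSkew λ′ μ a → InSkew λ′ μ b → Path (InSkew λ′ μ) a b)
  × (∀ i j → ¬ (InSkew λ′ μ (i , j) × InSkew λ′ μ (suc i , j)
               × InSkew λ′ μ (i , suc j) × InSkew λ′ μ (suc i , suc j)))

RemoveStrip : ℕ → List ℕ → List ℕ → Set
RemoveStrip t λ′ μ = BorderStrip t λ′ μ

IsTCoreOf : ℕ → List ℕ → List ℕ → Set
IsTCoreOf t λ′ κ = Star (RemoveStrip t) λ′ κ × (∀ μ → ¬ RemoveStrip t κ μ)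

-- β(λ,m) = (λ_j + m - j)_{j=1}^m  (here k = j - 1)
beta : List ℕ → ℕ → List ℕ
beta λ′ m = map (λ k → part λ′ k + (m ∸ suc k)) (upTo m)

nCount : (t : ℕ) → .{{NonZero t}} → List ℕ → ℕ → ℕ → ℕ
nCount t λ′ m i = length (filter (λ x → x % t ≟ i) (beta λ′ m))

{-# OPTIONS --safe #-}
-- Encode λ by its β-numbers β_k = λ_{k+1} + m - (k + 1) for k < m = tn + 1: a strictly decreasing
-- sequence, i.e. beads on the t-abacus whose runner i holds the β-numbers ≡ i mod t.  Removing a
-- border strip of size t occupying rows r, …, r + d amounts to replacing β_r by β_r - t, provided
-- that is not already a β-number; so strip removal never changes the counts n_i.  Hence if the
-- t-core is (c), then c < t and the counts are those of (c): n + 1 for i = c and n otherwise.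
-- Conversely, given these counts, remove strips as long as some bead can move up its runner.  On
-- the final flush abacus runner i carries the beads i, i + t, …, so the counts force β_0 = c + tn
-- and β_1 < tn, that is λ = (c).
module Submission where

open import Defs
open import Data.Bool using (Bool; true; false)
open import Data.Empty using (⊥-elim)
open import Data.Nat.Induction using (<-wellFounded)
open import Induction.WellFounded using (Acc; acc)
open import Data.List using (List; []; _∷_; length; map; filter; applyUpTo)
open import Data.List.Relation.Unary.All using (All; []; _∷_)
open import Data.List.Relation.Unary.Linked using (Linked; []; [-]; _∷_)
open import Data.Nat
open import Data.Nat.Properties
open import Data.Nat.DivMod
open import Data.Nat.Solver using (module +-*-Solver)
open import Data.Product using (Σ; _×_; _,_; proj₁; proj₂)
open import Data.Sum using (_⊎_; inj₁; inj₂)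
open import Function using (_∘_)
open import Function.Bundles using (_⇔_; mk⇔)
open import Level using (0ℓ)
open import Relation.Binary.Definitions using (tri<; tri≈; tri>)
open import Relation.Binary.PropositionalEquality
open import Relation.Nullary using (¬_; Dec; yes; no; does)
open import Relation.Nullary.Decidable using (dec-true; dec-false)
open import Relation.Binary.Construct.Closure.ReflexiveTransitive using (Star; ε; _◅_)
open import Relation.Unary using (Pred; Decidable)
open +-*-Solver

indicator : Bool → ℕ
indicator true  = 1
indicator false = 0

sumTo : (ℕ → ℕ) → ℕ → ℕ
sumTo f zero    = 0
sumTo f (suc d) = f 0 + sumTo (f ∘ suc) d

count : (ℕ → Bool) → ℕ → ℕ
count P = sumTo (indicator ∘ P)

sumTo-cong : ∀ d {f g : ℕ → ℕ} → (∀ j → j < d → f j ≡ g j) → sumTo f d ≡ sumTo g d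
sumTo-cong zero    f≡g = refl
sumTo-cong (suc d) f≡g = cong₂ _+_ (f≡g 0 z<s) (sumTo-cong d (λ j j<d → f≡g (suc j) (s<s j<d)))

sumTo-≡0 : ∀ d (f : ℕ → ℕ) → (∀ j → j < d → f j ≡ 0) → sumTo f d ≡ 0
sumTo-≡0 zero    f f≡0 = refl
sumTo-≡0 (suc d) f f≡0 = cong₂ _+_ (f≡0 0 z<s) (sumTo-≡0 d (f ∘ suc) (λ j j<d → f≡0 (suc j) (s<s j<d)))

sumTo-+ : ∀ a b (f : ℕ → ℕ) → sumTo f (a + b) ≡ sumTo f a + sumTo (λ j → f (a + j)) b
sumTo-+ zero    b f = refl
sumTo-+ (suc a) b f = trans (cong (f 0 +_) (sumTo-+ a b (f ∘ suc))) (sym (+-assoc (f 0) _ _))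

sumTo-suc : ∀ d (f : ℕ → ℕ) → sumTo f (suc d) ≡ sumTo f d + f d
sumTo-suc d f = begin
  sumTo f (suc d)                      ≡⟨ cong (sumTo f) (+-comm 1 d) ⟩
  sumTo f (d + 1)                      ≡⟨ sumTo-+ d 1 f ⟩
  sumTo f d + (f (d + 0) + 0)          ≡⟨ cong (λ x → sumTo f d + (f x + 0)) (+-identityʳ d) ⟩
  sumTo f d + (f d + 0)                ≡⟨ cong (sumTo f d +_) (+-identityʳ (f d)) ⟩
  sumTo f d + f d                      ∎
  where open ≡-Reasoning

sumTo-reverse : ∀ d (f : ℕ → ℕ) → sumTo (λ j → f (d ∸ suc j)) d ≡ sumTo f d
sumTo-reverse zero    f = refl
sumTo-reverse (suc d) f =
  trans (cong (f d +_) (sumTo-reverse d f)) (trans (+-comm (f d) _) (sym (sumTo-suc d f)))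

sumTo-rotate : ∀ d (f g : ℕ → ℕ) → (∀ k → k < d → g k ≡ f (suc k)) → g d ≡ f 0 →
  sumTo g (suc d) ≡ sumTo f (suc d)
sumTo-rotate d f g g≡f∘suc gd≡f0 = begin
  sumTo g (suc d)              ≡⟨ sumTo-suc d g ⟩
  sumTo g d + g d              ≡⟨ cong₂ _+_ (sumTo-cong d g≡f∘suc) gd≡f0 ⟩
  sumTo (f ∘ suc) d + f 0      ≡⟨ +-comm _ (f 0) ⟩
  sumTo f (suc d)              ∎
  where open ≡-Reasoning

sumTo-local : ∀ r d M {f g : ℕ → ℕ} {x y : ℕ} → r + d < M →
  (∀ k → k < r → f k ≡ g k) → (∀ k → r + d < k → f k ≡ g k) →
  sumTo (λ j → f (r + j)) (suc d) + x ≡ sumTo (λ j → g (r + j)) (suc d) + y →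
  sumTo f M + x ≡ sumTo g M + y
sumTo-local r d M {f} {g} {x} {y} r+d<M below above block = begin
    sumTo f M + x
  ≡⟨ cong (_+ x) (split f) ⟩
    sumTo f r + (F + Rf) + x
  ≡⟨ solve 4 (λ a b c e → a :+ (b :+ c) :+ e := a :+ (b :+ e) :+ c) refl (sumTo f r) F Rf x ⟩
    sumTo f r + (F + x) + Rf
  ≡⟨ cong₂ _+_ (cong₂ _+_ (sumTo-cong r below) block) (sumTo-cong e (λ j _ → above _ (r+d<r+sd+j j))) ⟩
    sumTo g r + (G + y) + Rg
  ≡⟨ solve 4 (λ a b c e → a :+ (b :+ e) :+ c := a :+ (b :+ c) :+ e) refl (sumTo g r) G Rg y ⟩
    sumTo g r + (G + Rg) + y
  ≡⟨ cong (_+ y) (sym (split g)) ⟩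
    sumTo g M + y
  ∎
  where
  open ≡-Reasoning
  e F G Rf Rg : ℕ
  e = M ∸ suc (r + d)
  F = sumTo (λ j → f (r + j)) (suc d)
  G = sumTo (λ j → g (r + j)) (suc d)
  Rf = sumTo (λ j → f (r + (suc d + j))) e
  Rg = sumTo (λ j → g (r + (suc d + j))) e
  M≡ : M ≡ r + (suc d + e)
  M≡ = trans (sym (m+[n∸m]≡n r+d<M)) (trans (cong (_+ e) (sym (+-suc r d))) (+-assoc r (suc d) e))
  split : ∀ h → sumTo h M ≡ sumTo h r + (sumTo (λ j → h (r + j)) (suc d) + sumTo (λ j → h (r + (suc d + j))) e)
  split h = trans (cong (sumTo h) M≡) (trans (sumTo-+ r (suc d + e) h) (cong (sumTo h r +_) (sumTo-+ (suc d) e (λ j → h (r + j)))))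
  r+d<r+sd+j : ∀ j → r + d < r + (suc d + j)
  r+d<r+sd+j j = +-monoʳ-< r (s≤s (m≤m+n d j))

count-mono : ∀ f {a b} → a ≤ b → count f a ≤ count f b
count-mono f {a} a≤b = subst (λ x → count f a ≤ count f x) (m+[n∸m]≡n a≤b)
  (subst (count f a ≤_) (sym (sumTo-+ a (_ ∸ a) (indicator ∘ f))) (m≤m+n _ _))

leastBelow : ∀ {P : ℕ → Set} → (∀ k → Dec (P k)) → ∀ M → Σ ℕ (λ k → k < M × P k) →
  Σ ℕ λ r → r < M × P r × (∀ k → k < r → ¬ P k)
leastBelow {P} P? (suc M) (k , k<M , Pk) with P? 0
... | yes P0 = 0 , z<s , P0 , λ _ ()
... | no ¬P0 with k
...   | zero   = ⊥-elim (¬P0 Pk)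
...   | suc k′ with leastBelow (P? ∘ suc) M (k′ , ≤-pred k<M , Pk)
...     | r , r<M , Pr , minimal = suc r , s≤s r<M , Pr , minimal′
  where
  minimal′ : ∀ x → x < suc r → ¬ P x
  minimal′ zero    _         = ¬P0
  minimal′ (suc x) (s≤s x<r) = minimal x x<r

greatestBelow : ∀ {P : ℕ → Set} → (∀ k → Dec (P k)) → ∀ M → Σ ℕ (λ k → k < M × P k) →
  Σ ℕ λ s → s < M × P s × (∀ k → s < k → k < M → ¬ P k)
greatestBelow {P} P? (suc M) (k , k<M , Pk) with P? M
... | yes PM = M , ≤-refl , PM , λ x M<x x<sM → ⊥-elim (<-irrefl refl (≤-trans x<sM M<x))
... | no ¬PM with m≤n⇒m<n∨m≡n (≤-pred k<M)
...   | inj₂ refl = ⊥-elim (¬PM Pk)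
...   | inj₁ k<M′ with greatestBelow P? M (k , k<M′ , Pk)
...     | s , s<M , Ps , maximal = s , ≤-trans s<M (n≤1+n M) , Ps , maximal′
  where
  maximal′ : ∀ x → s < x → x < suc M → ¬ P x
  maximal′ x s<x x<sM with m≤n⇒m<n∨m≡n (≤-pred x<sM)
  ... | inj₁ x<M = maximal x s<x x<M
  ... | inj₂ refl = ¬PM

Antitone : (ℕ → ℕ) → Set
Antitone q = ∀ k → q (suc k) ≤ q k

Antitone⇒≤ : ∀ {q} → Antitone q → ∀ {k k′} → k ≤ k′ → q k′ ≤ q k
Antitone⇒≤ {q} anti {k} k≤k′ = subst (λ x → q x ≤ q k) (m+[n∸m]≡n k≤k′) (go (_ ∸ k))
  where
  go : ∀ e → q (k + e) ≤ q k
  go zero    = ≤-reflexive (cong q (+-identityʳ k))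
  go (suc e) = ≤-trans (subst (λ x → q x ≤ q (k + e)) (sym (+-suc k e)) (anti (k + e))) (go e)

part-antitone : ∀ {l} → IsPartition l → Antitone (part l)
part-antitone {[]}        _                  k       = z≤n
part-antitone {x ∷ []}    _                  k       = z≤n
part-antitone {x ∷ y ∷ l} (x≥y ∷ _ , _)      zero    = x≥y
part-antitone {x ∷ y ∷ l} (_ ∷ lk , _ ∷ pos) (suc k) = part-antitone (lk , pos) k

part-positive : ∀ {l} → IsPartition l → ∀ {k} → k < length l → 0 < part l k
part-positive {x ∷ l}     (_ , x>0 ∷ _)       {zero}  _         = x>0
part-positive {x ∷ y ∷ l} (_ ∷ lk , _ ∷ pos) {suc k} (s≤s k<ℓ) = part-positive (lk , pos) k<ℓ

part-≥length : ∀ l {k} → length l ≤ k → part l k ≡ 0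
part-≥length []      _         = refl
part-≥length (x ∷ l) (s≤s ℓ≤k) = part-≥length l ℓ≤k

size≡sumTo-part : ∀ l {M} → length l ≤ M → size l ≡ sumTo (part l) M
size≡sumTo-part []      {M}     _         = sym (sumTo-≡0 M (λ _ → 0) (λ _ _ → refl))
size≡sumTo-part (x ∷ l) {suc M} (s≤s ℓ≤M) = cong (x +_) (size≡sumTo-part l ℓ≤M)

IsPartition-tail : ∀ {x l} → IsPartition (x ∷ l) → IsPartition l
IsPartition-tail {l = []}    _                = [] , []
IsPartition-tail {l = y ∷ l} (_ ∷ lk , _ ∷ pos) = lk , pos

part-injective : ∀ {xs ys} → IsPartition xs → IsPartition ys → (∀ k → part xs k ≡ part ys k) → xs ≡ ys
part-injective {[]}     {[]}     _  _                 _ = refl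
part-injective {[]}     {y ∷ ys} _  (_ , y>0 ∷ _) xs≗ys = ⊥-elim (<-irrefl (xs≗ys 0) y>0)
part-injective {x ∷ xs} {[]}     (_ , x>0 ∷ _) _  xs≗ys = ⊥-elim (<-irrefl (sym (xs≗ys 0)) x>0)
part-injective {x ∷ xs} {y ∷ ys} pxs pys xs≗ys =
  cong₂ _∷_ (xs≗ys 0) (part-injective (IsPartition-tail pxs) (IsPartition-tail pys) (xs≗ys ∘ suc))

length-mono : ∀ l {μ} → IsPartition μ → (∀ i → part μ i ≤ part l i) → length μ ≤ length l
length-mono l {μ} pμ μ⊆l with length μ ≤? length l
... | yes le = le
... | no  μ≰l = ⊥-elim (<-irrefl refl (≤-trans (part-positive pμ (≰⇒> μ≰l))
                  (≤-trans (μ⊆l (length l)) (≤-reflexive (part-≥length l ≤-refl)))))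

fromParts : (ℕ → ℕ) → ℕ → List ℕ
fromParts q zero = []
fromParts q (suc M) with q 0
... | zero  = []
... | suc v = suc v ∷ fromParts (q ∘ suc) M

fromParts-part : ∀ M {q} → Antitone q → (∀ k → M ≤ k → q k ≡ 0) → ∀ k → part (fromParts q M) k ≡ q k
fromParts-part zero    anti q≡0 k = sym (q≡0 k z≤n)
fromParts-part (suc M) {q} anti q≡0 k with q 0 in q0≡
... | zero  = sym (n≤0⇒n≡0 (subst (q k ≤_) q0≡ (Antitone⇒≤ anti z≤n)))
fromParts-part (suc M) anti q≡0 zero    | suc v = sym q0≡
fromParts-part (suc M) anti q≡0 (suc k) | suc v =
  fromParts-part M (anti ∘ suc) (λ j M≤j → q≡0 (suc j) (s≤s M≤j)) k

fromParts-length : ∀ M q → length (fromParts q M) ≤ M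
fromParts-length zero    q = z≤n
fromParts-length (suc M) q with q 0
... | zero  = z≤n
... | suc v = s≤s (fromParts-length M (q ∘ suc))

fromParts-positive : ∀ M q → All (0 <_) (fromParts q M)
fromParts-positive zero    q = []
fromParts-positive (suc M) q with q 0
... | zero  = []
... | suc v = z<s ∷ fromParts-positive M (q ∘ suc)

Linked-≥-from-part : ∀ l → Antitone (part l) → Linked _≥_ l
Linked-≥-from-part []          anti = []
Linked-≥-from-part (x ∷ [])    anti = [-]
Linked-≥-from-part (x ∷ y ∷ l) anti = anti 0 ∷ Linked-≥-from-part (y ∷ l) (anti ∘ suc)

fromParts-IsPartition : ∀ M {q} → Antitone q → (∀ k → M ≤ k → q k ≡ 0) → IsPartition (fromParts q M)
fromParts-IsPartition M {q} anti q≡0 = Linked-≥-from-part _ anti′ , fromParts-positive M q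
  where
  anti′ : Antitone (part (fromParts q M))
  anti′ k rewrite fromParts-part M anti q≡0 (suc k) | fromParts-part M anti q≡0 k = anti k

-- In terms of part functions p = part λ and q = part μ, the shape of the skew diagram λ/μ
-- of a border strip occupying rows r, …, r + d.
record RowShift (p q : ℕ → ℕ) (r d : ℕ) : Set where
  field
    below   : ∀ k → k < r → q k ≡ p k
    above   : ∀ k → r + d < k → q k ≡ p k
    shifted : ∀ k → k < d → suc (q (r + k)) ≡ p (suc (r + k))

record StripShape (t : ℕ) (p q : ℕ → ℕ) (r d : ℕ) : Set where
  field
    rowShift : RowShift p q r d
    lastRow  : q (r + d) + t ≡ p r + d
  open RowShift rowShift public

sumTo-shiftedBlock : ∀ d (P Q : ℕ → ℕ) → (∀ k → k < d → suc (Q k) ≡ P (suc k)) →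
  sumTo Q d + d ≡ sumTo (P ∘ suc) d
sumTo-shiftedBlock zero    P Q shifted = refl
sumTo-shiftedBlock (suc d) P Q shifted = begin
    Q 0 + sumTo (Q ∘ suc) d + suc d
  ≡⟨ solve 3 (λ a b c → a :+ b :+ (con 1 :+ c) := (con 1 :+ a) :+ (b :+ c)) refl (Q 0) (sumTo (Q ∘ suc) d) d ⟩
    suc (Q 0) + (sumTo (Q ∘ suc) d + d)
  ≡⟨ cong₂ _+_ (shifted 0 z<s) (sumTo-shiftedBlock d (P ∘ suc) (Q ∘ suc) (λ k k<d → shifted (suc k) (s<s k<d))) ⟩
    P 1 + sumTo (P ∘ suc ∘ suc) d
  ∎
  where open ≡-Reasoning

RowShift-sumTo : ∀ {p q r d} M → RowShift p q r d → r + d < M →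
  sumTo p M + q (r + d) ≡ sumTo q M + (p r + d)
RowShift-sumTo {p} {q} {r} {d} M shift r+d<M =
  sumTo-local r d M r+d<M (λ k k<r → sym (below k k<r)) (λ k r+d<k → sym (above k r+d<k)) (begin
      sumTo P (suc d) + Q d
    ≡⟨ cong (λ x → P 0 + x + Q d) (sym (sumTo-shiftedBlock d P Q shifted′)) ⟩
      P 0 + (sumTo Q d + d) + Q d
    ≡⟨ solve 4 (λ a b c e → a :+ (b :+ c) :+ e := b :+ e :+ (a :+ c)) refl (P 0) (sumTo Q d) d (Q d) ⟩
      sumTo Q d + Q d + (P 0 + d)
    ≡⟨ cong₂ (λ x y → x + (p y + d)) (sym (sumTo-suc d Q)) (+-identityʳ r) ⟩
      sumTo Q (suc d) + (p r + d)
    ∎)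
  where
  open ≡-Reasoning
  open RowShift shift
  P Q : ℕ → ℕ
  P j = p (r + j)
  Q j = q (r + j)
  shifted′ : ∀ k → k < d → suc (Q k) ≡ P (suc k)
  shifted′ k k<d = trans (shifted k k<d) (cong p (sym (+-suc r k)))

betaAt : (ℕ → ℕ) → ℕ → ℕ → ℕ
betaAt p m k = p k + (m ∸ suc k)

residueCount : (t : ℕ) → .{{NonZero t}} → (ℕ → ℕ) → ℕ → ℕ → ℕ
residueCount t b m i = count (λ k → does (b k % t ≟ i)) m

residueCount-cong : ∀ {t} .{{_ : NonZero t}} {b b′ m i} → (∀ k → k < m → b k ≡ b′ k) →
  residueCount t b m i ≡ residueCount t b′ m i
residueCount-cong {t} {i = i} b≗b′ = sumTo-cong _ (λ k k<m → cong (λ x → indicator (does (x % t ≟ i))) (b≗b′ k k<m))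

RowCounts : ℕ → (ℕ → ℕ) → ℕ → ℕ → Set
RowCounts t N n c = ∀ i → i < t → (i ≡ c → N i ≡ suc n) × (i ≢ c → N i ≡ n)

RowCounts-cong : ∀ {t N N′ n c} → (∀ i → N i ≡ N′ i) → RowCounts t N n c → RowCounts t N′ n c
RowCounts-cong N≗N′ counts i i<t = (λ i≡c → trans (sym (N≗N′ i)) (proj₁ (counts i i<t) i≡c))
                                 , (λ i≢c → trans (sym (N≗N′ i)) (proj₂ (counts i i<t) i≢c))

length-filter≡count : ∀ {P : Pred ℕ 0ℓ} (P? : Decidable P) (g h : ℕ → ℕ) d →
  length (filter P? (map g (applyUpTo h d))) ≡ count (λ j → does (P? (g (h j)))) d
length-filter≡count P? g h zero = refl
length-filter≡count P? g h (suc d) with does (P? (g (h 0)))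
... | true  = cong suc (length-filter≡count P? g (h ∘ suc) d)
... | false = length-filter≡count P? g (h ∘ suc) d

nCount≡residueCount : ∀ t .{{_ : NonZero t}} l m i → nCount t l m i ≡ residueCount t (betaAt (part l) m) m i
nCount≡residueCount t l m i = length-filter≡count (λ x → x % t ≟ i) (betaAt (part l) m) (λ k → k) m

m∸n≡suc[m∸suc[n]] : ∀ {m n} → n < m → m ∸ n ≡ suc (m ∸ suc n)
m∸n≡suc[m∸suc[n]] {suc m} {zero}  _         = refl
m∸n≡suc[m∸suc[n]] {suc m} {suc n} (s≤s n<m) = m∸n≡suc[m∸suc[n]] n<m

m∸suc[r]≡d+m∸suc[r+d] : ∀ {m} r d → r + d < m → m ∸ suc r ≡ d + (m ∸ suc (r + d))
m∸suc[r]≡d+m∸suc[r+d] {m} r d r+d<m = sym (begin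
    d + (m ∸ suc (r + d))  ≡⟨ cong (d +_) (sym (∸-+-assoc m (suc r) d)) ⟩
    d + (m ∸ suc r ∸ d)    ≡⟨ m+[n∸m]≡n (m+n≤o⇒m≤o∸n d (≤-trans (≤-reflexive (+-comm d (suc r))) r+d<m)) ⟩
    m ∸ suc r              ∎)
  where open ≡-Reasoning

m∸suc-surjective : ∀ m j y → j < m → y < m ∸ suc j → Σ ℕ λ k → j ≤ k × k < m × m ∸ suc k ≡ y
m∸suc-surjective m j y j<m y<m∸sj = k , j≤k , k<m , m∸sk≡y
  where
  z k : ℕ
  z = m ∸ suc j ∸ suc y
  k = suc j + z
  m≡ : m ≡ suc j + (suc y + z)
  m≡ = trans (sym (m+[n∸m]≡n j<m)) (cong (suc j +_) (sym (m+[n∸m]≡n y<m∸sj)))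
  j≤k : j ≤ k
  j≤k = ≤-trans (n≤1+n j) (m≤m+n (suc j) z)
  k<m : k < m
  k<m = subst (k <_) (sym m≡) (+-monoʳ-< (suc j) (s≤s (m≤n+m z y)))
  m∸sk≡y : m ∸ suc k ≡ y
  m∸sk≡y = trans (cong (_∸ suc k) m≡)
    (trans (cong (_∸ suc k) (solve 3 (λ a b c → con 1 :+ a :+ (con 1 :+ b :+ c) := con 1 :+ (con 1 :+ a :+ c) :+ b) refl j y z))
           (m+n∸m≡n (suc k) y))

module _ {t p q r d} (shape : StripShape t p q r d) {m} (r+d<m : r + d < m) where
  open StripShape shape

  StripShape-betaShifted : ∀ k → k < d → betaAt q m (r + k) ≡ betaAt p m (r + suc k)
  StripShape-betaShifted k k<d = begin
      q (r + k) + (m ∸ suc (r + k))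
    ≡⟨ cong (q (r + k) +_) (m∸n≡suc[m∸suc[n]] (≤-trans (s≤s (+-monoʳ-< r k<d)) r+d<m)) ⟩
      q (r + k) + suc (m ∸ suc (suc (r + k)))
    ≡⟨ +-suc (q (r + k)) _ ⟩
      suc (q (r + k)) + (m ∸ suc (suc (r + k)))
    ≡⟨ cong (_+ (m ∸ suc (suc (r + k)))) (shifted k k<d) ⟩
      p (suc (r + k)) + (m ∸ suc (suc (r + k)))
    ≡⟨ cong (λ x → p x + (m ∸ suc x)) (sym (+-suc r k)) ⟩
      p (r + suc k) + (m ∸ suc (r + suc k))
    ∎
    where open ≡-Reasoning

  StripShape-betaLast : betaAt q m (r + d) + t ≡ betaAt p m r
  StripShape-betaLast = begin
      q (r + d) + (m ∸ suc (r + d)) + t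
    ≡⟨ solve 3 (λ a b c → a :+ b :+ c := a :+ c :+ b) refl (q (r + d)) (m ∸ suc (r + d)) t ⟩
      q (r + d) + t + (m ∸ suc (r + d))
    ≡⟨ cong (_+ (m ∸ suc (r + d))) lastRow ⟩
      p r + d + (m ∸ suc (r + d))
    ≡⟨ +-assoc (p r) d _ ⟩
      p r + (d + (m ∸ suc (r + d)))
    ≡⟨ cong (p r +_) (sym (m∸suc[r]≡d+m∸suc[r+d] r d r+d<m)) ⟩
      p r + (m ∸ suc r)
    ∎
    where open ≡-Reasoning

  -- β_r becomes β_r - t and moves behind β_{r+1}, …, β_{r+d}: residues mod t are only permuted.
  StripShape-residueCount : ∀ .{{_ : NonZero t}} i →
    residueCount t (betaAt q m) m i ≡ residueCount t (betaAt p m) m i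
  StripShape-residueCount i = begin
      residueCount t (betaAt q m) m i      ≡⟨ sym (+-identityʳ _) ⟩
      residueCount t (betaAt q m) m i + 0  ≡⟨ sumTo-local r d m r+d<m outside-below outside-above (cong (_+ 0) block) ⟩
      residueCount t (betaAt p m) m i + 0  ≡⟨ +-identityʳ _ ⟩
      residueCount t (betaAt p m) m i      ∎
    where
    open ≡-Reasoning
    ind : ℕ → ℕ
    ind x = indicator (does (x % t ≟ i))
    outside-below : ∀ k → k < r → ind (betaAt q m k) ≡ ind (betaAt p m k)
    outside-below k k<r = cong (λ x → ind (x + (m ∸ suc k))) (below k k<r)
    outside-above : ∀ k → r + d < k → ind (betaAt q m k) ≡ ind (betaAt p m k)
    outside-above k r+d<k = cong (λ x → ind (x + (m ∸ suc k))) (above k r+d<k)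
    residue-last : betaAt q m (r + d) % t ≡ betaAt p m (r + 0) % t
    residue-last = trans (sym ([m+n]%n≡m%n _ t))
      (cong (_% t) (trans StripShape-betaLast (cong (betaAt p m) (sym (+-identityʳ r)))))
    block : sumTo (λ j → ind (betaAt q m (r + j))) (suc d) ≡ sumTo (λ j → ind (betaAt p m (r + j))) (suc d)
    block = sumTo-rotate d (λ j → ind (betaAt p m (r + j))) (λ j → ind (betaAt q m (r + j)))
      (λ k k<d → cong ind (StripShape-betaShifted k k<d))
      (cong (λ x → indicator (does (x ≟ i))) residue-last)

Adjacent-sym : ∀ a b → Adjacent a b → Adjacent b a
Adjacent-sym _ _ (inj₁ (refl , inj₁ refl)) = inj₁ (refl , inj₂ refl)
Adjacent-sym _ _ (inj₁ (refl , inj₂ refl)) = inj₁ (refl , inj₁ refl)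
Adjacent-sym _ _ (inj₂ (refl , inj₁ refl)) = inj₂ (refl , inj₂ refl)
Adjacent-sym _ _ (inj₂ (refl , inj₂ refl)) = inj₂ (refl , inj₁ refl)

path-snoc : ∀ {S a b c} → Path S a b → Adjacent b c → S c → Path S a c
path-snoc here           b~c Sc = step b~c Sc here
path-snoc (step a~ Sb p) b~c Sc = step a~ Sb (path-snoc p b~c Sc)

path-reverse : ∀ {S a b} → S a → Path S a b → Path S b a
path-reverse     Sa here                     = here
path-reverse {a = a} Sa (step {b = b} a~b Sb p) = path-snoc (path-reverse Sb p) (Adjacent-sym a b a~b) Sa

path-++ : ∀ {S a b c} → Path S a b → Path S b c → Path S a c
path-++ here           q = q
path-++ (step a~ Sb p) q = step a~ Sb (path-++ p q)

path-crossesRow : ∀ {S : ℕ × ℕ → Set} K {a b} → S a → Path S a b → proj₁ a ≤ K → K < proj₁ b →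
  Σ ℕ λ j → S (K , j) × S (suc K , j)
path-crossesRow K Sa here a≤K K<b = ⊥-elim (<-irrefl refl (≤-trans K<b a≤K))
path-crossesRow K {a = i , j} Sa (step {b = i′ , j′} a~ Sb rest) a≤K K<b with i′ ≤? K
... | yes i′≤K = path-crossesRow K Sb rest i′≤K K<b
... | no  i′≰K with a~
...   | inj₁ (refl , _)        = ⊥-elim (i′≰K a≤K)
...   | inj₂ (refl , inj₂ refl) = ⊥-elim (i′≰K (≤-trans (n≤1+n i′) a≤K))
...   | inj₂ (refl , inj₁ refl) with ≤-antisym a≤K (≤-pred (≰⇒> i′≰K))
...     | refl = j , Sa , Sb

module _ {t} (t>0 : 0 < t) {l μ} (pl : IsPartition l) (strip : BorderStrip t l μ) where
  private
    p q : ℕ → ℕ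
    p = part l
    q = part μ

    pμ : IsPartition μ
    pμ = proj₁ strip

    μ⊆λ : ∀ i → q i ≤ p i
    μ⊆λ = proj₁ (proj₂ strip)

    size≡ : size l ≡ size μ + t
    size≡ = proj₁ (proj₂ (proj₂ strip))

    connected : ∀ a b → InSkew l μ a → InSkew l μ b → Path (InSkew l μ) a b
    connected = proj₁ (proj₂ (proj₂ (proj₂ strip)))

    no2×2 : ∀ i j → ¬ (InSkew l μ (i , j) × InSkew l μ (suc i , j)
                       × InSkew l μ (i , suc j) × InSkew l μ (suc i , suc j))
    no2×2 = proj₂ (proj₂ (proj₂ (proj₂ strip)))

    L : ℕ
    L = length l

    sumTo-size : sumTo p L ≡ sumTo q L + t
    sumTo-size = trans (sym (size≡sumTo-part l ≤-refl))
      (trans size≡ (cong (_+ t) (size≡sumTo-part μ (length-mono l pμ μ⊆λ))))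

    Changed : ℕ → Set
    Changed k = q k < p k

    unchanged : ∀ k → ¬ Changed k → q k ≡ p k
    unchanged k ¬ch = ≤∧≮⇒≡ (μ⊆λ k) ¬ch

    someChanged : Σ ℕ λ k → k < L × Changed k
    someChanged with anyUpTo? (λ k → q k <? p k) L
    ... | yes ch = ch
    ... | no ¬ch = ⊥-elim (<-irrefl (sym t≡0) t>0)
      where
      t≡0 : t ≡ 0
      t≡0 = +-cancelˡ-≡ (sumTo q L) t 0 (begin
          sumTo q L + t  ≡⟨ sym sumTo-size ⟩
          sumTo p L      ≡⟨ sumTo-cong L (λ k k<L → sym (unchanged k (λ ch → ¬ch (k , k<L , ch)))) ⟩
          sumTo q L      ≡⟨ sym (+-identityʳ _) ⟩
          sumTo q L + 0  ∎)
        where open ≡-Reasoning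

    first : Σ ℕ λ r → r < L × Changed r × (∀ k → k < r → ¬ Changed k)
    first = leastBelow (λ k → q k <? p k) L someChanged

    last : Σ ℕ λ s → s < L × Changed s × (∀ k → s < k → k < L → ¬ Changed k)
    last = greatestBelow (λ k → q k <? p k) L someChanged

    r s d : ℕ
    r = proj₁ first
    s = proj₁ last
    d = s ∸ r

    r<L : r < L
    r<L = proj₁ (proj₂ first)

    s<L : s < L
    s<L = proj₁ (proj₂ last)

    changed-r : Changed r
    changed-r = proj₁ (proj₂ (proj₂ first))

    changed-s : Changed s
    changed-s = proj₁ (proj₂ (proj₂ last))

    r+d≡s : r + d ≡ s
    r+d≡s with r ≤? s
    ... | yes r≤s = m+[n∸m]≡n r≤s
    ... | no  r≰s = ⊥-elim (proj₂ (proj₂ (proj₂ last)) r (≰⇒> r≰s) r<L changed-r)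

    r+d<L : r + d < L
    r+d<L = subst (_< L) (sym r+d≡s) s<L

    below : ∀ k → k < r → q k ≡ p k
    below k k<r = unchanged k (proj₂ (proj₂ (proj₂ first)) k k<r)

    above : ∀ k → r + d < k → q k ≡ p k
    above k r+d<k with k <? L
    ... | yes k<L = unchanged k (proj₂ (proj₂ (proj₂ last)) k (subst (_< k) r+d≡s r+d<k) k<L)
    ... | no  k≮L = trans (n≤0⇒n≡0 (subst (q k ≤_) p≡0 (μ⊆λ k))) (sym p≡0)
      where
      p≡0 : p k ≡ 0
      p≡0 = part-≥length l (≮⇒≥ k≮L)

    -- A path in λ/μ from row r to row s crosses from row K to K + 1 in column q K, and the
    -- absence of 2 × 2 squares forbids the strip to reach further right in row K + 1.
    shifted : ∀ k → k < d → suc (q (r + k)) ≡ p (suc (r + k))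
    shifted k k<d = ≤-antisym lower upper
      where
      K : ℕ
      K = r + k
      crossing : Σ ℕ λ j → InSkew l μ (K , j) × InSkew l μ (suc K , j)
      crossing = path-crossesRow K (changed-r , n≮n (q r))
                   (connected _ (s , q s) (changed-r , n≮n (q r)) (changed-s , n≮n (q s)))
                   (m≤m+n r k) (subst (K <_) r+d≡s (+-monoʳ-< r k<d))
      j : ℕ
      j = proj₁ crossing
      qK≤j : q K ≤ j
      qK≤j = ≮⇒≥ (proj₂ (proj₁ (proj₂ crossing)))
      lower : suc (q K) ≤ p (suc K)
      lower = ≤-trans (s≤s qK≤j) (proj₁ (proj₂ (proj₂ crossing)))
      q-anti : q (suc K) ≤ q K
      q-anti = part-antitone pμ K
      upper : p (suc K) ≤ suc (q K)
      upper with p (suc K) ≤? suc (q K)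
      ... | yes le = le
      ... | no  p≰ = ⊥-elim (no2×2 K (q K)
              ( (≤-trans (s≤s qK≤j) (proj₁ (proj₁ (proj₂ crossing))) , n≮n (q K))
              , (≤-trans (n≤1+n _) wide , ≤⇒≯ q-anti)
              , (≤-trans wide (part-antitone pl K) , ≤⇒≯ (n≤1+n (q K)))
              , (wide , ≤⇒≯ (≤-trans q-anti (n≤1+n _))) ))
        where
        wide : suc (suc (q K)) ≤ p (suc K)
        wide = ≰⇒> p≰

    rowShift : RowShift p q r d
    rowShift = record { below = below ; above = above ; shifted = shifted }

    lastRow : q (r + d) + t ≡ p r + d
    lastRow = +-cancelˡ-≡ (sumTo q L) _ _ (begin
        sumTo q L + (q (r + d) + t)
      ≡⟨ solve 3 (λ a b c → a :+ (b :+ c) := a :+ c :+ b) refl (sumTo q L) (q (r + d)) t ⟩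
        sumTo q L + t + q (r + d)
      ≡⟨ cong (_+ q (r + d)) (sym sumTo-size) ⟩
        sumTo p L + q (r + d)
      ≡⟨ RowShift-sumTo L rowShift r+d<L ⟩
        sumTo q L + (p r + d)
      ∎)
      where open ≡-Reasoning

  BorderStrip⇒StripShape : Σ ℕ λ r → Σ ℕ λ d → StripShape t (part l) (part μ) r d × r + d < length l
  BorderStrip⇒StripShape = r , d , record { rowShift = rowShift ; lastRow = lastRow } , r+d<L

blockTrichotomy : ∀ r d k → k < r ⊎ (Σ ℕ (λ k′ → k′ ≤ d × k ≡ r + k′) ⊎ r + d < k)
blockTrichotomy r d k with k <? r
... | yes k<r = inj₁ k<r
... | no  k≮r with k ∸ r ≤? d
...   | yes k∸r≤d = inj₂ (inj₁ (k ∸ r , k∸r≤d , sym (m+[n∸m]≡n (≮⇒≥ k≮r))))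
...   | no  k∸r≰d = inj₂ (inj₂ (subst (r + d <_) (m+[n∸m]≡n (≮⇒≥ k≮r)) (+-monoʳ-< r (≰⇒> k∸r≰d))))

module _ {t l} (pl : IsPartition l) {q r d} (shape : StripShape t (part l) q r d)
         (lastRow-nonempty : q (r + d) < part l (r + d)) (fits : part l (suc (r + d)) ≤ q (r + d)) where
  open StripShape shape
  private
    p : ℕ → ℕ
    p = part l

    L s : ℕ
    L = length l
    s = r + d

    block-nonempty : ∀ k′ → k′ ≤ d → q (r + k′) < p (r + k′)
    block-nonempty k′ k′≤d with m≤n⇒m<n∨m≡n k′≤d
    ... | inj₁ k′<d = ≤-trans (≤-reflexive (shifted k′ k′<d)) (part-antitone pl (r + k′))
    ... | inj₂ refl = lastRow-nonempty

    q⊆p : ∀ k → q k ≤ p k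
    q⊆p k with blockTrichotomy r d k
    ... | inj₁ k<r                      = ≤-reflexive (below k k<r)
    ... | inj₂ (inj₂ s<k)               = ≤-reflexive (above k s<k)
    ... | inj₂ (inj₁ (k′ , k′≤d , refl)) = <⇒≤ (block-nonempty k′ k′≤d)

    q-antitone : Antitone q
    q-antitone k with blockTrichotomy r d k
    ... | inj₁ k<r = ≤-trans (q⊆p (suc k)) (≤-trans (part-antitone pl k) (≤-reflexive (sym (below k k<r))))
    ... | inj₂ (inj₂ s<k) = ≤-trans (≤-reflexive (above (suc k) (≤-trans s<k (n≤1+n k))))
                              (≤-trans (part-antitone pl k) (≤-reflexive (sym (above k s<k))))
    ... | inj₂ (inj₁ (k′ , k′≤d , refl)) with m≤n⇒m<n∨m≡n k′≤d
    ...   | inj₂ refl = ≤-trans (≤-reflexive (above (suc s) ≤-refl)) fits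
    ...   | inj₁ k′<d = ≤-pred (≤-trans (subst (λ x → suc (q x) ≤ p x) (+-suc r k′) (block-nonempty (suc k′) k′<d))
                          (≤-reflexive (sym (shifted k′ k′<d))))

    s<L : s < L
    s<L with s <? L
    ... | yes s<L = s<L
    ... | no  s≮L = ⊥-elim (n≮0 (subst (q s <_) (part-≥length l (≮⇒≥ s≮L)) lastRow-nonempty))

    q-vanishes : ∀ k → L ≤ k → q k ≡ 0
    q-vanishes k L≤k = n≤0⇒n≡0 (subst (q k ≤_) (part-≥length l L≤k) (q⊆p k))

    μ : List ℕ
    μ = fromParts q L

    part-μ : ∀ k → part μ k ≡ q k
    part-μ = fromParts-part L q-antitone q-vanishes

    μ⊆λ : ∀ i → part μ i ≤ p i
    μ⊆λ i = subst (_≤ p i) (sym (part-μ i)) (q⊆p i)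

    size≡ : size l ≡ size μ + t
    size≡ = +-cancelʳ-≡ (q s) _ _ (begin
        size l + q s         ≡⟨ cong (_+ q s) (size≡sumTo-part l ≤-refl) ⟩
        sumTo p L + q s      ≡⟨ RowShift-sumTo L rowShift s<L ⟩
        sumTo q L + (p r + d) ≡⟨ cong (sumTo q L +_) (sym lastRow) ⟩
        sumTo q L + (q s + t) ≡⟨ solve 3 (λ a b c → a :+ (b :+ c) := a :+ c :+ b) refl (sumTo q L) (q s) t ⟩
        sumTo q L + t + q s  ≡⟨ cong (λ x → x + t + q s) (sym size-μ) ⟩
        size μ + t + q s     ∎)
      where
      open ≡-Reasoning
      size-μ : size μ ≡ sumTo q L
      size-μ = trans (size≡sumTo-part μ (fromParts-length L q)) (sumTo-cong L (λ k _ → part-μ k))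

    S : ℕ × ℕ → Set
    S = InSkew l μ

    skew-intro : ∀ {i j} → q i ≤ j → j < p i → S (i , j)
    skew-intro {i} {j} q≤j j<p = j<p , λ j<μ → <-irrefl refl (≤-trans (subst (j <_) (part-μ i) j<μ) q≤j)

    skew-elim : ∀ {i j} → S (i , j) → q i ≤ j × j < p i
    skew-elim {i} {j} (j<p , j≮μ) = ≮⇒≥ (λ j<q → j≮μ (subst (j <_) (sym (part-μ i)) j<q)) , j<p

    skew-rows : ∀ {i j} → q i ≤ j → j < p i → Σ ℕ λ k′ → k′ ≤ d × i ≡ r + k′
    skew-rows {i} {j} q≤j j<p with blockTrichotomy r d i
    ... | inj₁ i<r        = ⊥-elim (<-irrefl refl (≤-trans j<p (subst (_≤ j) (below i i<r) q≤j)))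
    ... | inj₂ (inj₂ s<i) = ⊥-elim (<-irrefl refl (≤-trans j<p (subst (_≤ j) (above i s<i) q≤j)))
    ... | inj₂ (inj₁ blk) = blk

    pathLeft : ∀ i j e → q i ≤ j → e + j < p i → Path S (i , e + j) (i , j)
    pathLeft i j zero    q≤j _   = here
    pathLeft i j (suc e) q≤j e+j<p =
      step (inj₁ (refl , inj₂ refl)) (skew-intro (≤-trans q≤j (m≤n+m j e)) (≤-trans (n≤1+n _) e+j<p))
           (pathLeft i j e q≤j (≤-trans (n≤1+n _) e+j<p))

    pathToRowStart : ∀ i j → q i ≤ j → j < p i → Path S (i , j) (i , q i)
    pathToRowStart i j q≤j j<p = subst (λ x → Path S (i , x) (i , q i)) (m∸n+n≡m q≤j)
      (pathLeft i (q i) (j ∸ q i) ≤-refl (subst (_< p i) (sym (m∸n+n≡m q≤j)) j<p))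

    -- Go left to the start of the row, then down one row: the strip is a connected staircase.
    pathToCorner : ∀ e k′ j → k′ + e ≡ d → q (r + k′) ≤ j → j < p (r + k′) → Path S (r + k′ , j) (s , q s)
    pathToCorner zero k′ j k′+0≡d q≤j j<p with trans (sym (+-identityʳ k′)) k′+0≡d
    ... | refl = pathToRowStart s j q≤j j<p
    pathToCorner (suc e) k′ j k′+e≡d q≤j j<p = path-++ (pathToRowStart (r + k′) j q≤j j<p)
        (step (inj₂ (refl , inj₁ refl)) (skew-intro (q-antitone (r + k′)) below-start)
          (subst (λ x → Path S (x , q (r + k′)) (s , q s)) (+-suc r k′)
            (pathToCorner e (suc k′) (q (r + k′)) (trans (sym (+-suc k′ e)) k′+e≡d)
              (subst (λ x → q x ≤ q (r + k′)) (sym (+-suc r k′)) (q-antitone (r + k′)))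
              (subst (λ x → q (r + k′) < p x) (sym (+-suc r k′)) below-start))))
      where
      k′<d : k′ < d
      k′<d = subst (k′ <_) k′+e≡d (≤-trans (s≤s (m≤m+n k′ e)) (≤-reflexive (sym (+-suc k′ e))))
      below-start : q (r + k′) < p (suc (r + k′))
      below-start = ≤-reflexive (shifted k′ k′<d)

    pathToCorner′ : ∀ c → S c → Path S c (s , q s)
    pathToCorner′ (i , j) Sc with skew-elim Sc
    ... | q≤j , j<p with skew-rows q≤j j<p
    ...   | k′ , k′≤d , refl = pathToCorner (d ∸ k′) k′ j (m+[n∸m]≡n k′≤d) q≤j j<p

    connected : ∀ a b → S a → S b → Path S a b
    connected a b Sa Sb = path-++ (pathToCorner′ a Sa) (path-reverse Sb (pathToCorner′ b Sb))

    no2×2 : ∀ i j → ¬ (S (i , j) × S (suc i , j) × S (i , suc j) × S (suc i , suc j))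
    no2×2 i j (S₁ , S₂ , _ , S₄) with skew-elim S₁ | skew-elim S₂ | skew-elim S₄
    ... | q≤j , j<p | q≤j′ , j<p′ | _ , j<p″ with skew-rows q≤j j<p | skew-rows q≤j′ j<p′
    ...   | k′ , _ , refl | k″ , k″≤d , i+1≡ =
      <-irrefl refl (≤-trans (s≤s q≤j) (≤-pred (subst (suc (suc j) ≤_) (sym (shifted k′ k′<d)) j<p″)))
      where
      k′<d : k′ < d
      k′<d = +-cancelˡ-≤ r (suc k′) d (≤-trans (≤-reflexive (+-suc r k′)) (≤-trans (≤-reflexive i+1≡) (+-monoʳ-≤ r k″≤d)))

  StripShape⇒BorderStrip : Σ (List ℕ) λ μ → BorderStrip t l μ × (∀ k → part μ k ≡ q k)
  StripShape⇒BorderStrip =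
    μ , (fromParts-IsPartition L q-antitone q-vanishes , μ⊆λ , size≡ , connected , no2×2) , part-μ

BorderStrip-residueCount : ∀ {t} .{{_ : NonZero t}} {l μ m} → IsPartition l → BorderStrip t l μ →
  length l ≤ m → ∀ i → residueCount t (betaAt (part l) m) m i ≡ residueCount t (betaAt (part μ) m) m i
BorderStrip-residueCount {t} pl strip ℓ≤m i =
  let _ , _ , shape , r+d<ℓ = BorderStrip⇒StripShape (>-nonZero⁻¹ t) pl strip
  in sym (StripShape-residueCount shape (≤-trans r+d<ℓ ℓ≤m) i)

BorderStrip-length : ∀ {t} l {μ} → BorderStrip t l μ → length μ ≤ length l
BorderStrip-length l (pμ , μ⊆λ , _) = length-mono l pμ μ⊆λ

BorderStrip-size< : ∀ {t} → 0 < t → ∀ {l μ} → BorderStrip t l μ → size μ < size l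
BorderStrip-size< {t} t>0 {μ = μ} (_ , _ , size≡ , _) =
  subst (size μ <_) (sym size≡) (subst (_< size μ + t) (+-identityʳ (size μ)) (+-monoʳ-< (size μ) t>0))

Star-residueCount : ∀ {t} .{{_ : NonZero t}} {l κ m} → Star (RemoveStrip t) l κ → IsPartition l →
  length l ≤ m → ∀ i → residueCount t (betaAt (part l) m) m i ≡ residueCount t (betaAt (part κ) m) m i
Star-residueCount ε                 pl ℓ≤m i = refl
Star-residueCount {l = l} (strip ◅ strips) pl ℓ≤m i =
  trans (BorderStrip-residueCount pl strip ℓ≤m i)
        (Star-residueCount strips (proj₁ strip) (≤-trans (BorderStrip-length l strip) ℓ≤m) i)

row-part-zero : ∀ c → part (row c) 0 ≡ c
row-part-zero zero    = refl
row-part-zero (suc c) = refl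

row-part-suc : ∀ c k → part (row c) (suc k) ≡ 0
row-part-suc zero    k = refl
row-part-suc (suc c) k = refl

row-size : ∀ c → size (row c) ≡ c
row-size zero    = refl
row-size (suc c) = cong suc (+-identityʳ c)

row-IsPartition : ∀ c → IsPartition (row c)
row-IsPartition zero    = [] , []
row-IsPartition (suc c) = [-] , (z<s ∷ [])

-- A row of length c ≥ t contains the horizontal strip formed by its last t cells.
row-core⇒<t : ∀ {t} → 0 < t → ∀ c → (∀ μ → ¬ RemoveStrip t (row c) μ) → c < t
row-core⇒<t {t} t>0 c core with c <? t
... | yes c<t = c<t
... | no  c≮t = ⊥-elim (core (proj₁ strip) (proj₁ (proj₂ strip)))
  where
  t≤c : t ≤ c
  t≤c = ≮⇒≥ c≮t
  q : ℕ → ℕ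
  q zero    = c ∸ t
  q (suc k) = 0
  shape : StripShape t (part (row c)) q 0 0
  shape = record
    { rowShift = record { below = λ _ () ; above = above ; shifted = λ _ () }
    ; lastRow  = trans (m∸n+n≡m t≤c) (sym (trans (+-identityʳ _) (row-part-zero c))) }
    where
    above : ∀ k → 0 < k → q k ≡ part (row c) k
    above (suc k) _ = sym (row-part-suc c k)
  strip : Σ (List ℕ) λ μ → BorderStrip t (row c) μ × (∀ k → part μ k ≡ q k)
  strip = StripShape⇒BorderStrip (row-IsPartition c) shape
            (subst (c ∸ t <_) (sym (row-part-zero c)) (∸-monoʳ-< t>0 t≤c))
            (subst (_≤ c ∸ t) (sym (row-part-suc c 0)) z≤n)

count-≟ : ∀ T {i} → i < T → count (λ j → does (j ≟ i)) T ≡ 1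
count-≟ (suc T) {i} i<1+T with m≤n⇒m<n∨m≡n (≤-pred i<1+T)
... | inj₁ i<T = trans (sumTo-suc T _)
      (cong₂ _+_ (count-≟ T i<T) (cong indicator (dec-false (T ≟ i) (λ T≡i → <-irrefl (sym T≡i) i<T))))
... | inj₂ refl = trans (sumTo-suc T _)
      (cong₂ _+_ (sumTo-≡0 T _ (λ j j<T → cong indicator (dec-false (j ≟ T) (λ j≡T → <-irrefl j≡T j<T))))
                 (cong indicator (dec-true (T ≟ T) refl)))

count-residue-multiple : ∀ t .{{_ : NonZero t}} n {i} → i < t → count (λ x → does (x % t ≟ i)) (t * n) ≡ n
count-residue-multiple t zero    {i} i<t = cong (count _) (*-zeroʳ t)
count-residue-multiple t (suc n) {i} i<t = begin
    sumTo f (t * suc n)                          ≡⟨ cong (sumTo f) (trans (*-suc t n) (+-comm t (t * n))) ⟩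
    sumTo f (t * n + t)                          ≡⟨ sumTo-+ (t * n) t f ⟩
    sumTo f (t * n) + sumTo (λ j → f (t * n + j)) t
      ≡⟨ cong₂ _+_ (count-residue-multiple t n i<t) (trans (sumTo-cong t last-block) (count-≟ t i<t)) ⟩
    n + 1                                        ≡⟨ +-comm n 1 ⟩
    suc n                                        ∎
  where
  open ≡-Reasoning
  f : ℕ → ℕ
  f x = indicator (does (x % t ≟ i))
  last-block : ∀ j → j < t → f (t * n + j) ≡ indicator (does (j ≟ i))
  last-block j j<t = cong (λ y → indicator (does (y ≟ i)))
    (trans (cong (_% t) (trans (+-comm (t * n) j) (cong (j +_) (*-comm t n))))
           (trans ([m+kn]%n≡m%n j n t) (m<n⇒m%n≡m j<t)))

-- β((c), tn + 1) = (c + tn, tn - 1, …, 1, 0).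
row-residueCount : ∀ t .{{_ : NonZero t}} n {c i} → c < t → i < t →
  residueCount t (betaAt (part (row c)) (t * n + 1)) (t * n + 1) i ≡ indicator (does (c ≟ i)) + n
row-residueCount t n {c} {i} c<t i<t rewrite +-comm (t * n) 1 = cong₂ _+_ first rest
  where
  N : ℕ
  N = t * n
  ind : ℕ → ℕ
  ind x = indicator (does (x % t ≟ i))
  first : ind (part (row c) 0 + N) ≡ indicator (does (c ≟ i))
  first = cong (λ y → indicator (does (y ≟ i)))
    (trans (cong (λ x → (x + N) % t) (row-part-zero c))
      (trans (cong (λ z → (c + z) % t) (*-comm t n)) (trans ([m+kn]%n≡m%n c n t) (m<n⇒m%n≡m c<t))))
  rest : sumTo (λ j → ind (part (row c) (suc j) + (N ∸ suc j))) N ≡ n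
  rest = trans (sumTo-cong N (λ j _ → cong (λ x → ind (x + (N ∸ suc j))) (row-part-suc c j)))
               (trans (sumTo-reverse N ind) (count-residue-multiple t n i<t))

row-noStrip : ∀ {t c} → c < t → ∀ μ → ¬ RemoveStrip t (row c) μ
row-noStrip {t} {c} c<t μ (_ , _ , size≡ , _) =
  <⇒≱ c<t (subst (t ≤_) (trans (sym size≡) (row-size c)) (m≤n+m t (size μ)))

row-RowCounts : ∀ t .{{_ : NonZero t}} n {c} → c < t →
  RowCounts t (residueCount t (betaAt (part (row c)) (t * n + 1)) (t * n + 1)) n c
row-RowCounts t n {c} c<t i i<t =
    (λ i≡c → trans count≡ (cong (λ x → indicator x + n) (dec-true (c ≟ i) (sym i≡c))))
  , (λ i≢c → trans count≡ (cong (λ x → indicator x + n) (dec-false (c ≟ i) (i≢c ∘ sym))))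
  where
  count≡ : residueCount t (betaAt (part (row c)) (t * n + 1)) (t * n + 1) i ≡ indicator (does (c ≟ i)) + n
  count≡ = row-residueCount t n c<t i<t

StrictlyDecreasing : (ℕ → ℕ) → ℕ → Set
StrictlyDecreasing b m = ∀ k k′ → k < k′ → k′ < m → b k′ < b k

StrictlyDecreasing⇒≤ : ∀ {b m} → StrictlyDecreasing b m → ∀ {k k′} → k ≤ k′ → k′ < m → b k′ ≤ b k
StrictlyDecreasing⇒≤ decr {k} {k′} k≤k′ k′<m with m≤n⇒m<n∨m≡n k≤k′
... | inj₁ k<k′ = <⇒≤ (decr k k′ k<k′ k′<m)
... | inj₂ refl = ≤-refl

betaAt-strictlyDecreasing : ∀ {l} → IsPartition l → ∀ m → StrictlyDecreasing (betaAt (part l) m) m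
betaAt-strictlyDecreasing pl m k k′ k<k′ k′<m =
  +-mono-≤-< (Antitone⇒≤ (part-antitone pl) (<⇒≤ k<k′)) (∸-monoʳ-< {m} {suc k′} {suc k} (s≤s k<k′) k′<m)

-- The indices hitting v 0 < v 1 < … decrease strictly, hence are distinct.
count-≥-values : ∀ {b m} → StrictlyDecreasing b m → (f : ℕ → Bool) (v : ℕ → ℕ) →
  (∀ j j′ → j < j′ → v j < v j′) → ∀ N U → U ≤ m →
  (∀ j → j < N → Σ ℕ λ k → k < U × b k ≡ v j × f k ≡ true) → N ≤ count f U
count-≥-values decr f v v-incr zero    U U≤m hits = z≤n
count-≥-values {b} decr f v v-incr (suc N) U U≤m hits with hits 0 z<s
... | K , K<U , bK≡v0 , fK = begin
    suc N                 ≤⟨ s≤s (count-≥-values decr f (v ∘ suc) (λ j j′ j<j′ → v-incr _ _ (s<s j<j′)) N K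
                                   (<⇒≤ (≤-trans K<U U≤m)) hits′) ⟩
    suc (count f K)       ≡⟨ +-comm 1 (count f K) ⟩
    count f K + 1         ≡⟨ sym (trans (sumTo-suc K (indicator ∘ f)) (cong (count f K +_) (cong indicator fK))) ⟩
    count f (suc K)       ≤⟨ count-mono f K<U ⟩
    count f U             ∎
  where
  open ≤-Reasoning
  hits′ : ∀ j → j < N → Σ ℕ λ k → k < K × b k ≡ v (suc j) × f k ≡ true
  hits′ j j<N with hits (suc j) (s<s j<N)
  ... | k , k<U , bk≡ , fk with k <? K
  ...   | yes k<K = k , k<K , bk≡ , fk
  ...   | no  k≮K = ⊥-elim (<-irrefl refl (≤-trans (v-incr 0 (suc j) z<s)
            (≤-trans (≤-reflexive (sym bk≡)) (≤-trans (StrictlyDecreasing⇒≤ decr (≮⇒≥ k≮K) (≤-trans k<U U≤m)) (≤-reflexive bK≡v0)))))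

-- No t-strip can be removed: on the t-abacus every bead has a bead directly above it.
Flush : ℕ → (ℕ → ℕ) → ℕ → Set
Flush t b m = ∀ r → r < m → t ≤ b r → Σ ℕ λ k → k < m × b k + t ≡ b r

Flush-iterate : ∀ {t b m} → Flush t b m → ∀ D r → r < m → D * t ≤ b r → Σ ℕ λ k → k < m × b k + D * t ≡ b r
Flush-iterate flush zero    r r<m _ = r , r<m , +-identityʳ _
Flush-iterate {t} {b} flush (suc D) r r<m Dt≤br with Flush-iterate flush D r r<m (≤-trans (m≤n+m (D * t) t) Dt≤br)
... | k , k<m , bk+Dt≡br with flush k k<m (+-cancelʳ-≤ (D * t) t (b k) (≤-trans Dt≤br (≤-reflexive (sym bk+Dt≡br))))
...   | k′ , k′<m , bk′+t≡bk = k′ , k′<m , trans (sym (+-assoc (b k′) t (D * t))) (trans (cong (_+ D * t) bk′+t≡bk) bk+Dt≡br)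

-- On a flush abacus the runner of the bead x carries all of x mod t, x mod t + t, …, x.
Flush-residueCount : ∀ {t} .{{_ : NonZero t}} {b m} → StrictlyDecreasing b m → Flush t b m → ∀ r → r < m →
  suc (b r / t) ≤ residueCount t b m (b r % t)
Flush-residueCount {t} {b} {m} decr flush r r<m =
  count-≥-values decr (λ k → does (b k % t ≟ x % t)) (λ j → x % t + j * t)
    (λ j j′ j<j′ → +-monoʳ-< (x % t) (*-monoˡ-< t j<j′)) (suc (x / t)) m ≤-refl hit
  where
  x : ℕ
  x = b r
  hit : ∀ j → j < suc (x / t) → Σ ℕ λ k → k < m × b k ≡ x % t + j * t × does (b k % t ≟ x % t) ≡ true
  hit j j≤x/t with Flush-iterate flush (x / t ∸ j) r r<m
                     (≤-trans (*-monoˡ-≤ t (m∸n≤m (x / t) j)) (≤-trans (m≤n+m _ (x % t)) (≤-reflexive (sym (m≡m%n+[m/n]*n x t)))))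
  ... | k , k<m , bk+≡x = k , k<m , bk≡ , dec-true (b k % t ≟ x % t)
          (trans (cong (_% t) bk≡) (trans ([m+kn]%n≡m%n (x % t) j t) (m%n%n≡m%n x t)))
    where
    bk≡ : b k ≡ x % t + j * t
    bk≡ = +-cancelʳ-≡ ((x / t ∸ j) * t) (b k) _ (begin
        b k + (x / t ∸ j) * t              ≡⟨ bk+≡x ⟩
        x                                  ≡⟨ m≡m%n+[m/n]*n x t ⟩
        x % t + x / t * t                  ≡⟨ cong (λ z → x % t + z * t) (sym (m+[n∸m]≡n (≤-pred j≤x/t))) ⟩
        x % t + (j + (x / t ∸ j)) * t      ≡⟨ cong (x % t +_) (*-distribʳ-+ t j (x / t ∸ j)) ⟩
        x % t + (j * t + (x / t ∸ j) * t)  ≡⟨ sym (+-assoc (x % t) _ _) ⟩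
        x % t + j * t + (x / t ∸ j) * t    ∎)
      where open ≡-Reasoning

-- A runner holding n + 1 beads on a flush abacus ends at c + n t, all others below n t.
Flush-largeBead : ∀ {t} .{{_ : NonZero t}} {b m n c} → StrictlyDecreasing b m → Flush t b m →
  RowCounts t (residueCount t b m) n c → ∀ r → r < m → n * t ≤ b r → b r ≡ c + n * t × c < t
Flush-largeBead {t} {b} {m} {n} {c} decr flush counts r r<m nt≤br =
  trans (m≡m%n+[m/n]*n (b r) t) (cong₂ (λ u w → u + w * t) residue≡c (≤-antisym x/t≤n n≤x/t)) ,
  subst (_< t) residue≡c (m%n<n (b r) t)
  where
  beads : suc (b r / t) ≤ residueCount t b m (b r % t)
  beads = Flush-residueCount decr flush r r<m
  n≤x/t : n ≤ b r / t
  n≤x/t = subst (_≤ b r / t) (m*n/n≡m n t) (/-monoˡ-≤ t nt≤br)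
  residue≡c : b r % t ≡ c
  residue≡c with b r % t ≟ c
  ... | yes ≡c = ≡c
  ... | no  ≢c = ⊥-elim (<-irrefl refl (≤-trans (s≤s n≤x/t)
                   (≤-trans beads (≤-reflexive (proj₂ (counts _ (m%n<n (b r) t)) ≢c)))))
  x/t≤n : b r / t ≤ n
  x/t≤n = ≤-pred (≤-trans beads (≤-reflexive (proj₁ (counts _ (m%n<n (b r) t)) residue≡c)))

Gap : ℕ → (ℕ → ℕ) → ℕ → ℕ → Set
Gap t b m r = t ≤ b r × ¬ (Σ ℕ λ k → k < m × b k + t ≡ b r)

Gap? : ∀ t b m r → Dec (Gap t b m r)
Gap? t b m r with t ≤? b r | anyUpTo? (λ k → b k + t ≟ b r) m
... | yes t≤br | no  ¬bead = yes (t≤br , ¬bead)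
... | yes _    | yes bead  = no (λ gap → proj₂ gap bead)
... | no  t≰br | _         = no (λ gap → t≰br (proj₁ gap))

Flush⊎Gap : ∀ t b m → Flush t b m ⊎ Σ ℕ λ r → r < m × Gap t b m r
Flush⊎Gap t b m with anyUpTo? (Gap? t b m) m
... | yes gap  = inj₂ gap
... | no  ¬gap = inj₁ flush
  where
  flush : Flush t b m
  flush r r<m t≤br with anyUpTo? (λ k → b k + t ≟ b r) m
  ... | yes bead = bead
  ... | no ¬bead = ⊥-elim (¬gap (r , r<m , t≤br , ¬bead))

-- Moving the bead β_r up its runner into the empty position β_r - t removes a border strip:
-- it sweeps over the rows r … s whose β-numbers lie strictly between β_r - t and β_r.
module _ {t} .{{_ : NonZero t}} {m l} (pl : IsPartition l) (ℓ≤m : length l ≤ m) {r} (r<m : r < m)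
         (gap : Gap t (betaAt (part l) m) m r) where
  private
    p b : ℕ → ℕ
    p = part l
    b = betaAt p m

    t≤βr : t ≤ b r
    t≤βr = proj₁ gap

    y : ℕ
    y = b r ∸ t

    y+t≡βr : y + t ≡ b r
    y+t≡βr = m∸n+n≡m t≤βr

    y-free : ∀ k → k < m → b k ≢ y
    y-free k k<m βk≡y = proj₂ gap (k , k<m , trans (cong (_+ t) βk≡y) y+t≡βr)

    y<βr : y < b r
    y<βr = subst (y <_) y+t≡βr (subst (_< y + t) (+-identityʳ y) (+-monoʳ-< y (>-nonZero⁻¹ t)))

    last : Σ ℕ λ s → s < m × y < b s × (∀ k → s < k → k < m → ¬ y < b k)
    last = greatestBelow (λ k → y <? b k) m (r , r<m , y<βr)

    s d S W : ℕ
    s = proj₁ last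
    d = s ∸ r
    S = r + d
    W = m ∸ suc S

    r+d≡s : r + d ≡ s
    r+d≡s with r ≤? s
    ... | yes r≤s = m+[n∸m]≡n r≤s
    ... | no  r≰s = ⊥-elim (proj₂ (proj₂ (proj₂ last)) r (≰⇒> r≰s) r<m y<βr)

    S<m : S < m
    S<m = subst (_< m) (sym r+d≡s) (proj₁ (proj₂ last))

    y<βS : y < b S
    y<βS = subst (λ x → y < b x) (sym r+d≡s) (proj₁ (proj₂ (proj₂ last)))

    βr≡ : b r ≡ p r + d + W
    βr≡ = trans (cong (p r +_) (m∸suc[r]≡d+m∸suc[r+d] r d S<m)) (sym (+-assoc (p r) d W))

    -- From an empty row j on, β_k = m - 1 - k runs through all values below β_j, and y < β_S ≤ β_j.
    block-nonempty : ∀ j → j ≤ S → 1 ≤ p j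
    block-nonempty j j≤S with p j ≟ 0
    ... | no  pj≢0 = n≢0⇒n>0 pj≢0
    ... | yes pj≡0 with m∸suc-surjective m j y (≤-trans (s≤s j≤S) S<m) y<m∸sj
      where
      y<m∸sj : y < m ∸ suc j
      y<m∸sj = ≤-trans y<βS (≤-trans (StrictlyDecreasing⇒≤ (betaAt-strictlyDecreasing pl m) j≤S S<m)
                                     (≤-reflexive (cong (_+ (m ∸ suc j)) pj≡0)))
    ...   | k , j≤k , k<m , m∸sk≡y = ⊥-elim (y-free k k<m (trans (cong (_+ (m ∸ suc k)) pk≡0) m∸sk≡y))
      where
      pk≡0 : p k ≡ 0
      pk≡0 = n≤0⇒n≡0 (subst (p k ≤_) pj≡0 (Antitone⇒≤ (part-antitone pl) j≤k))

    -- β_{S+1} < y, phrased so that it also covers S + 1 = m (read β_m as -1).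
    β[S+1]<y : p (suc S) + W ≤ y
    β[S+1]<y with suc S <? m
    ... | no  S+1≮m = subst (_≤ y) (sym (trans (cong₂ _+_ (part-≥length l (≤-trans ℓ≤m (≮⇒≥ S+1≮m)))
                                                          (m≤n⇒m∸n≡0 (≮⇒≥ S+1≮m))) refl)) z≤n
    ... | yes S+1<m = subst (_≤ y) (trans (sym (+-suc (p (suc S)) _)) (cong (p (suc S) +_) (sym (m∸n≡suc[m∸suc[n]] S+1<m)))) β[S+1]<y′
      where
      β[S+1]<y′ : b (suc S) < y
      β[S+1]<y′ with <-cmp (b (suc S)) y
      ... | tri< lt _ _ = lt
      ... | tri≈ _ eq _ = ⊥-elim (y-free (suc S) S+1<m eq)
      ... | tri> _ _ gt = ⊥-elim (proj₂ (proj₂ (proj₂ last)) (suc S) (subst (_< suc S) r+d≡s ≤-refl) S+1<m gt)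

    t≤pr+d : t ≤ p r + d
    t≤pr+d = +-cancelʳ-≤ W t (p r + d) (begin
      t + W                    ≡⟨ +-comm t W ⟩
      W + t                    ≤⟨ +-monoˡ-≤ t (≤-trans (m≤n+m W (p (suc S))) β[S+1]<y) ⟩
      y + t                    ≡⟨ trans y+t≡βr βr≡ ⟩
      p r + d + W              ∎)
      where open ≤-Reasoning

    newLast : ℕ
    newLast = p r + d ∸ t

    newLast+W≡y : newLast + W ≡ y
    newLast+W≡y = +-cancelʳ-≡ t _ _ (begin
      newLast + W + t          ≡⟨ solve 3 (λ a b c → a :+ b :+ c := a :+ c :+ b) refl newLast W t ⟩
      newLast + t + W          ≡⟨ cong (_+ W) (m∸n+n≡m t≤pr+d) ⟩
      p r + d + W              ≡⟨ sym (trans y+t≡βr βr≡) ⟩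
      y + t                    ∎)
      where open ≡-Reasoning

    q : ℕ → ℕ
    q k with k <? r
    ... | yes _ = p k
    ... | no  _ with S <? k
    ...   | yes _ = p k
    ...   | no  _ with k <? S
    ...     | yes _ = p (suc k) ∸ 1
    ...     | no  _ = newLast

    q-below : ∀ k → k < r → q k ≡ p k
    q-below k k<r with k <? r
    ... | yes _   = refl
    ... | no  k≮r = ⊥-elim (k≮r k<r)

    q-above : ∀ k → S < k → q k ≡ p k
    q-above k S<k with k <? r
    ... | yes _ = refl
    ... | no  _ with S <? k
    ...   | yes _   = refl
    ...   | no  S≮k = ⊥-elim (S≮k S<k)

    q-shifted : ∀ k → k < d → suc (q (r + k)) ≡ p (suc (r + k))
    q-shifted k k<d with r + k <? r
    ... | yes r+k<r = ⊥-elim (<-irrefl refl (≤-trans r+k<r (m≤m+n r k)))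
    ... | no  _ with S <? r + k
    ...   | yes S<r+k = ⊥-elim (<-irrefl refl (≤-trans S<r+k (+-monoʳ-≤ r (<⇒≤ k<d))))
    ...   | no  _ with r + k <? S
    ...     | yes _     = trans (+-comm 1 _) (m∸n+n≡m (block-nonempty (suc (r + k)) (+-monoʳ-< r k<d)))
    ...     | no  r+k≮S = ⊥-elim (r+k≮S (+-monoʳ-< r k<d))

    q-last : q S ≡ newLast
    q-last with S <? r
    ... | yes S<r = ⊥-elim (<-irrefl refl (≤-trans S<r (m≤m+n r d)))
    ... | no  _ with S <? S
    ...   | yes S<S = ⊥-elim (<-irrefl refl S<S)
    ...   | no  _ with S <? S
    ...     | yes S<S = ⊥-elim (<-irrefl refl S<S)
    ...     | no  _   = refl

    shape : StripShape t p q r d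
    shape = record
      { rowShift = record { below = q-below ; above = q-above ; shifted = q-shifted }
      ; lastRow  = trans (cong (_+ t) q-last) (m∸n+n≡m t≤pr+d) }

    strip : Σ (List ℕ) λ μ → BorderStrip t l μ × (∀ k → part μ k ≡ q k)
    strip = StripShape⇒BorderStrip pl shape
      (subst (_< p S) (sym q-last) (+-cancelʳ-< W newLast (p S) (subst (_< b S) (sym newLast+W≡y) y<βS)))
      (subst (p (suc S) ≤_) (sym q-last) (+-cancelʳ-≤ W _ _ (subst (p (suc S) + W ≤_) (sym newLast+W≡y) β[S+1]<y)))

  gap⇒removableStrip : Σ (List ℕ) λ μ → BorderStrip t l μ ×
    (∀ i → residueCount t (betaAt (part μ) m) m i ≡ residueCount t (betaAt p m) m i)
  gap⇒removableStrip = proj₁ strip , proj₁ (proj₂ strip) , λ i →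
    trans (residueCount-cong {m = m} {i} (λ k _ → cong (_+ (m ∸ suc k)) (proj₂ (proj₂ strip) k)))
          (StripShape-residueCount shape S<m i)

-- On a flush abacus with these residue counts β_0 = c + tn, and β_1 ≥ tn would force β_1 = β_0.
flush⇒row : ∀ {t} .{{_ : NonZero t}} {n} → 1 ≤ n → ∀ {c l} → IsPartition l →
  Flush t (betaAt (part l) (t * n + 1)) (t * n + 1) → RowCounts t (residueCount t (betaAt (part l) (t * n + 1)) (t * n + 1)) n c →
  l ≡ row c × c < t
flush⇒row {t} {n} n≥1 {c} {l} pl flush counts =
  part-injective pl (row-IsPartition c) l≗row , proj₂ large₀
  where
  m : ℕ
  m = t * n + 1
  p b : ℕ → ℕ
  p = part l
  b = betaAt p m
  decr : StrictlyDecreasing b m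
  decr = betaAt-strictlyDecreasing pl m
  1<m : 1 < m
  1<m = +-monoˡ-≤ 1 (*-mono-≤ (>-nonZero⁻¹ t) n≥1)
  m∸1≡tn : m ∸ 1 ≡ t * n
  m∸1≡tn = m+n∸n≡m (t * n) 1
  large₀ : b 0 ≡ c + n * t × c < t
  large₀ = Flush-largeBead decr flush counts 0 (≤-trans (s≤s z≤n) 1<m)
             (subst (_≤ b 0) (trans m∸1≡tn (*-comm t n)) (m≤n+m (m ∸ 1) (p 0)))
  p₀≡c : p 0 ≡ c
  p₀≡c = +-cancelʳ-≡ (t * n) (p 0) c
    (trans (cong (p 0 +_) (sym m∸1≡tn)) (trans (proj₁ large₀) (cong (c +_) (*-comm n t))))
  p₁≡0 : p 1 ≡ 0
  p₁≡0 with p 1 ≟ 0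
  ... | yes p₁≡0 = p₁≡0
  ... | no  p₁≢0 = ⊥-elim (<-irrefl (trans (proj₁ large₁) (sym (proj₁ large₀))) (decr 0 1 (s≤s z≤n) 1<m))
    where
    large₁ : b 1 ≡ c + n * t × c < t
    large₁ = Flush-largeBead decr flush counts 1 1<m
      (subst (_≤ b 1) (trans (sym (m∸n≡suc[m∸suc[n]] 1<m)) (trans m∸1≡tn (*-comm t n)))
             (+-monoˡ-≤ (m ∸ 2) (n≢0⇒n>0 p₁≢0)))
  l≗row : ∀ k → part l k ≡ part (row c) k
  l≗row zero    = trans p₀≡c (sym (row-part-zero c))
  l≗row (suc k) = trans (n≤0⇒n≡0 (subst (p (suc k) ≤_) p₁≡0 (Antitone⇒≤ (part-antitone pl) (s≤s z≤n))))
                        (sym (row-part-suc c k))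

reachesRow : ∀ {t} .{{_ : NonZero t}} {n} → 1 ≤ n → ∀ {c l} → Acc _<_ (size l) → IsPartition l →
  length l ≤ t * n + 1 → RowCounts t (residueCount t (betaAt (part l) (t * n + 1)) (t * n + 1)) n c →
  Star (RemoveStrip t) l (row c) × c < t
reachesRow {t} {n} n≥1 {c} {l} (acc smaller) pl ℓ≤m counts
  with Flush⊎Gap t (betaAt (part l) (t * n + 1)) (t * n + 1)
... | inj₁ flush =
  let l≡row , c<t = flush⇒row n≥1 pl flush counts
  in subst (λ x → Star (RemoveStrip t) x (row c)) (sym l≡row) ε , c<t
... | inj₂ (r , r<m , gap) =
  let _ , strip , μ≗λ = gap⇒removableStrip pl ℓ≤m r<m gap
      strips , c<t = reachesRow n≥1 (smaller (BorderStrip-size< (>-nonZero⁻¹ t) {l} strip)) (proj₁ strip)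
                       (≤-trans (BorderStrip-length l strip) ℓ≤m) (RowCounts-cong (sym ∘ μ≗λ) counts)
  in strip ◅ strips , c<t

lemma4p1 : (t : ℕ) → .{{_ : NonZero t}} → 2 ≤ t → (n : ℕ) → 1 ≤ n →
    (λ′ : List ℕ) → IsPartition λ′ → length λ′ ≤ t * n + 1 → (c : ℕ) →
    (IsTCoreOf t λ′ (row c)
      ⇔ (∀ i → i < t →
           (i ≡ c → nCount t λ′ (t * n + 1) i ≡ suc n)
           × (i ≢ c → nCount t λ′ (t * n + 1) i ≡ n)))
lemma4p1 t _ n n≥1 l pl ℓ≤m c = mk⇔ core⇒counts counts⇒core
  where
  m : ℕ
  m = t * n + 1
  nCount≡ : ∀ i → nCount t l m i ≡ residueCount t (betaAt (part l) m) m i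
  nCount≡ = nCount≡residueCount t l m
  core⇒counts : IsTCoreOf t l (row c) → RowCounts t (nCount t l m) n c
  core⇒counts (strips , core) = RowCounts-cong (λ i → sym (trans (nCount≡ i) (Star-residueCount strips pl ℓ≤m i)))
    (row-RowCounts t n (row-core⇒<t (>-nonZero⁻¹ t) c core))
  counts⇒core : RowCounts t (nCount t l m) n c → IsTCoreOf t l (row c)
  counts⇒core counts =
    let strips , c<t = reachesRow n≥1 (<-wellFounded (size l)) pl ℓ≤m (RowCounts-cong nCount≡ counts)
    in strips , row-noStrip c<t
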